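{- Let $m,n,u,k$ be integers with $u\geq 0$, $k\geq 2$, $n\geq 2$ and $m\geq\max\{u+1,(k-1)(n-1)\}$. Let $\mathcal{L}(u+1,1;m,n;k)$ be the set of lattice paths from $(u+1,1)$ to $(m,n)$ using unit steps $(1,0)$ and $(0,1)$ all of whose lattice points $(x,y)$ satisfy $y\leq \frac{x-1}{k-1}+1$. Then $$|\mathcal{L}(u+1,1;m,n;k)|=\sum_{i=0}^{\lfloor u/k\rfloor}(-1)^i\,\frac{m-(k-1)(n-1)}{m+n-1-ki}\binom{m+n-1-ki}{n-1-i}\binom{u-(k-1)i}{i}.$$
   Context: A lattice path "stays below" the line $y=\frac{x-1}{k-1}+1$ in the weak sense: every lattice point of the path lies on or below this line. Binomial coefficients $\binom{N}{r}$ with $N\ge 0$ are $0$ for $r<0$ or $r>N$; $\lfloor x\rfloor$ is the floor function. -}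

module Defs where

open import Data.Bool using (Bool; true; false; _∧_)
open import Data.Nat using (ℕ; zero; suc; _+_; _*_; _∸_; _≤ᵇ_; _≡ᵇ_)
open import Data.Nat.Combinatorics using (_C_)
open import Data.Integer as ℤ using (ℤ; +_; -[1+_])
open import Data.Rational as ℚ using (ℚ; 0ℚ; 1ℚ; _/_)
open import Data.List using (List; []; _∷_; map; _++_; filter; length; foldr; upTo)
open import Data.Product using (_×_; _,_)

-- Lattice paths
-- A path is a list of unit steps: true = (1,0) (east), false = (0,1) (north).

Step : Set
Step = Bool

allSeqs : ℕ → List (List Step)
allSeqs zero    = [] ∷ []
allSeqs (suc l) = map (true ∷_) (allSeqs l) ++ map (false ∷_) (allSeqs l)

move : Step → ℕ × ℕ → ℕ × ℕ
move true  (x , y) = (suc x , y)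
move false (x , y) = (x , suc y)

endPt : ℕ × ℕ → List Step → ℕ × ℕ
endPt p []       = p
endPt p (s ∷ ss) = endPt (move s p) ss

-- the point (x,y) (with x,y ≥ 1) lies weakly below y = (x-1)/(k-1) + 1,
-- i.e. y - 1 ≤ (x-1)/(k-1), i.e. (k-1)(y-1) ≤ x-1   (k ≥ 2, so k-1 > 0)
below : ℕ → ℕ × ℕ → Bool
below k (x , y) = ((k ∸ 1) * (y ∸ 1)) ≤ᵇ (x ∸ 1)

allBelow : ℕ → ℕ × ℕ → List Step → Bool
allBelow k p []       = below k p
allBelow k p (s ∷ ss) = below k p ∧ allBelow k (move s p) ss

_≡ₚ_ : ℕ × ℕ → ℕ × ℕ → Bool
(a , b) ≡ₚ (c , d) = (a ≡ᵇ c) ∧ (b ≡ᵇ d)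

inL : ℕ → ℕ → ℕ → ℕ → ℕ → List Step → Bool
inL x0 y0 m n k ss = (endPt (x0 , y0) ss ≡ₚ (m , n)) ∧ allBelow k (x0 , y0) ss

-- the set L(x0,y0; m,n; k), enumerated: any path from (x0,y0) to (m,n)
-- with unit E/N steps has exactly (m - x0) + (n - y0) steps.
Lpaths : ℕ → ℕ → ℕ → ℕ → ℕ → List (List Step)
Lpaths x0 y0 m n k =
  filter (λ ss → Data.Bool._≟_ (inL x0 y0 m n k ss) true)
         (allSeqs ((m ∸ x0) + (n ∸ y0)))

numL : ℕ → ℕ → ℕ → ℕ → ℕ → ℕ
numL x0 y0 m n k = length (Lpaths x0 y0 m n k)

-- binomial coefficient C(N, r) for N ≥ 0, r ∈ ℤ; zero for r < 0
-- (and stdlib's N C r is zero for r > N)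
binomZ : ℕ → ℤ → ℕ
binomZ N (+ r)      = N C r
binomZ N -[1+ _ ]   = 0

-- p / d as a rational; the case d = 0 never occurs in the theorem
-- (the denominator there is ≥ n ≥ 2) and is given the junk value 0
frac : ℤ → ℕ → ℚ
frac p zero    = 0ℚ
frac p (suc d) = p / suc d

sgn : ℕ → ℚ
sgn zero    = 1ℚ
sgn (suc i) = ℚ.- (sgn i)

sumTo : ℕ → (ℕ → ℚ) → ℚ
sumTo b f = foldr ℚ._+_ 0ℚ (map f (upTo (suc b)))

summand : ℕ → ℕ → ℕ → ℕ → ℕ → ℚ
summand m n u k i =
  sgn i ℚ.* frac (+ m ℤ.- (+ (k ∸ 1)) ℤ.* (+ (n ∸ 1))) N
        ℚ.* ((+ binomZ N ((+ n ℤ.- + 1) ℤ.- + i)) / 1)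
        ℚ.* ((+ ((u ∸ (k ∸ 1) * i) C i)) / 1)
  where
  N : ℕ
  N = (m + n ∸ 1) ∸ k * i

-- ⌊u / k⌋ (k ≥ 2 in the theorem; junk 0 for k = 0)
floorDiv : ℕ → ℕ → ℕ
floorDiv u zero    = 0
floorDiv u (suc k) = Data.Nat._/_ u (suc k)

toℚ : ℕ → ℚ
toℚ a = (+ a) / 1

-- Shift coordinates by (1 , 1) and put a = k - 1 ≥ 1: the paths become east/north
-- walks from (u , 0) to (M , N) = (m - 1 , n - 1) inside the region a·y ≤ x.
--  * `walks` counts such walks by their first step; it agrees with the enumeration
--    numL of Defs (count-walks) and is invariant under translation by (a , 1).
--  * Ballot theorem (walks-ballot): split by the last step, walks from the origin to an
--    admissible (X , Y) obey Pascal's recursion, and so do the ballot numbers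
--    C(X+Y+1 , Y) - (a+1)·C(X+Y , Y-1) = (X+1-a·Y)/(X+Y+1) · C(X+Y+1 , Y).
--  * Inclusion–exclusion (toTarget-expansion): the walks from x + 1 are those from x
--    minus those whose first step is north.  By induction on the distance u from the
--    boundary point (y·a , y), the count from (y·a + u , y) is
--    Σ_i (-1)^i C(u - i·a , i) · B(y + i), with B(j) the ballot count from (j·a , j).
--  * For y = 0 the coefficients vanish beyond ⌊u/(a+1)⌋ and each B(i) is the fraction
--    of the theorem, giving its sum embedded in ℚ (walks-formula); when a·N = M + 1
--    the target is outside the region and both sides vanish.
module Submission where

open import Defs
open import Data.Nat using (ℕ; _≤_; _⊔_; _∸_; _*_; suc)
open import Relation.Binary.PropositionalEquality using (_≡_)

open import Data.Bool using (Bool; true; false; _∧_; if_then_else_; T)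
import Data.Bool as Bool
open import Data.Bool.Properties using (∧-zeroʳ)
open import Data.Empty using (⊥-elim)
open import Data.Integer as ℤ using (ℤ; +_)
import Data.Integer.Properties as ℤP
import Data.Integer.Tactic.RingSolver as ℤ-Solver
open import Data.List using (List; []; _∷_; map; _++_; filter; length; foldr; applyUpTo)
open import Data.Nat
open import Data.Nat.Combinatorics using (_C_; nCk+nC[k+1]≡[n+1]C[k+1]; k>n⇒nCk≡0)
open import Data.Nat.DivMod using (m≡m%n+[m/n]*n; m%n<n; m/n≤m)
open import Data.Nat.Induction using (<-rec)
open import Data.Nat.Properties
open import Algebra.Properties.CommutativeSemigroup +-commutativeSemigroup using (interchange)
import Data.Nat.Tactic.RingSolver as ℕ-Solver
open import Data.Product using (_,_)
open import Data.Rational as ℚ using (ℚ; 0ℚ; toℚᵘ)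
import Data.Rational.Properties as ℚP
open import Data.Rational.Unnormalised as ℚᵘ using (mkℚᵘ; *≡*) renaming (_≃_ to _≃ᵘ_)
import Data.Rational.Unnormalised.Properties as ℚᵘP
open import Function using (id; _∘_)
open import Relation.Binary.PropositionalEquality
open import Relation.Nullary using (¬_; yes; no; contradiction)

count : {A : Set} → (A → Bool) → List A → ℕ
count f []       = 0
count f (x ∷ xs) = if f x then suc (count f xs) else count f xs

length-filter : {A : Set} (f : A → Bool) (xs : List A) →
  length (filter (λ x → Bool._≟_ (f x) true) xs) ≡ count f xs
length-filter f []       = refl
length-filter f (x ∷ xs) with f x
... | true  = cong suc (length-filter f xs)
... | false = length-filter f xs

count-++ : {A : Set} (f : A → Bool) (xs ys : List A) →
  count f (xs ++ ys) ≡ count f xs + count f ys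
count-++ f []       ys = refl
count-++ f (x ∷ xs) ys with f x
... | true  = cong suc (count-++ f xs ys)
... | false = count-++ f xs ys

count-map : {A B : Set} (f : B → Bool) (g : A → B) (xs : List A) →
  count f (map g xs) ≡ count (λ x → f (g x)) xs
count-map f g []       = refl
count-map f g (x ∷ xs) with f (g x)
... | true  = cong suc (count-map f g xs)
... | false = count-map f g xs

count-guard : {A : Set} (b : Bool) (f g : A → Bool) (xs : List A) →
  count (λ x → f x ∧ (b ∧ g x)) xs ≡ (if b then count (λ x → f x ∧ g x) xs else 0)
count-guard true  f g xs       = refl
count-guard false f g []       = refl
count-guard false f g (x ∷ xs) rewrite ∧-zeroʳ (f x) = count-guard false f g xs

≤ᵇ-true : ∀ {m n} → m ≤ n → (m ≤ᵇ n) ≡ true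
≤ᵇ-true {m} {n} m≤n with m ≤ᵇ n | ≤⇒≤ᵇ m≤n
... | true | _ = refl

≤ᵇ-false : ∀ {m n} → ¬ m ≤ n → (m ≤ᵇ n) ≡ false
≤ᵇ-false {m} {n} m≰n with m ≤ᵇ n in eq
... | true  = ⊥-elim (m≰n (≤ᵇ⇒≤ m n (subst T (sym eq) _)))
... | false = refl

≡ᵇ-refl : ∀ n → (n ≡ᵇ n) ≡ true
≡ᵇ-refl zero    = refl
≡ᵇ-refl (suc n) = ≡ᵇ-refl n

≡ᵇ-false : ∀ {m n} → m ≢ n → (m ≡ᵇ n) ≡ false
≡ᵇ-false {m} {n} m≢n with m ≡ᵇ n in eq
... | true  = ⊥-elim (m≢n (≡ᵇ⇒≡ m n (subst T (sym eq) _)))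
... | false = refl

module Walks (a M N : ℕ) where

  -- These are the paths of the theorem in coordinates shifted by (1 , 1), with a = k - 1.
  walks : ℕ → ℕ → ℕ → ℕ
  walks x y zero    = if ((x ≡ᵇ M) ∧ (y ≡ᵇ N)) ∧ (a * y ≤ᵇ x) then 1 else 0
  walks x y (suc l) = if a * y ≤ᵇ x then walks (suc x) y l + walks x (suc y) l else 0

  admissibleFrom : ℕ → ℕ → List Step → Bool
  admissibleFrom x y ss = (endPt (suc x , suc y) ss ≡ₚ (suc M , suc N)) ∧ allBelow (suc a) (suc x , suc y) ss

  count-walks : ∀ x y l → count (admissibleFrom x y) (allSeqs l) ≡ walks x y l
  count-walks x y zero    = refl
  count-walks x y (suc l) = begin
      count f (map (true ∷_) (allSeqs l) ++ map (false ∷_) (allSeqs l))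
    ≡⟨ count-++ f (map (true ∷_) (allSeqs l)) (map (false ∷_) (allSeqs l)) ⟩
      count f (map (true ∷_) (allSeqs l)) + count f (map (false ∷_) (allSeqs l))
    ≡⟨ cong₂ _+_ (count-map f (true ∷_) (allSeqs l)) (count-map f (false ∷_) (allSeqs l)) ⟩
      count (λ s → f (true ∷ s)) (allSeqs l) + count (λ s → f (false ∷ s)) (allSeqs l)
    ≡⟨ cong₂ _+_ (count-guard b (reaches (suc x) y) (stays (suc x) y) (allSeqs l))
                 (count-guard b (reaches x (suc y)) (stays x (suc y)) (allSeqs l)) ⟩
      (if b then count (admissibleFrom (suc x) y) (allSeqs l) else 0)
        + (if b then count (admissibleFrom x (suc y)) (allSeqs l) else 0)
    ≡⟨ cong₂ (λ p q → (if b then p else 0) + (if b then q else 0))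
             (count-walks (suc x) y l) (count-walks x (suc y) l) ⟩
      (if b then walks (suc x) y l else 0) + (if b then walks x (suc y) l else 0)
    ≡⟨ if-+ b ⟩
      walks x y (suc l)
    ∎
    where
    open ≡-Reasoning
    b : Bool
    b = a * y ≤ᵇ x
    reaches stays : ℕ → ℕ → List Step → Bool
    reaches x' y' ss = endPt (suc x' , suc y') ss ≡ₚ (suc M , suc N)
    stays   x' y' ss = allBelow (suc a) (suc x' , suc y') ss
    f : List Step → Bool
    f = admissibleFrom x y
    if-+ : ∀ c → (if c then walks (suc x) y l else 0) + (if c then walks x (suc y) l else 0)
                 ≡ (if c then walks (suc x) y l + walks x (suc y) l else 0)
    if-+ true  = refl
    if-+ false = refl

  walks-step : ∀ {x y} l → a * y ≤ x → walks x y (suc l) ≡ walks (suc x) y l + walks x (suc y) l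
  walks-step l p rewrite ≤ᵇ-true p = refl

  walks-outside : ∀ {x y} l → ¬ a * y ≤ x → walks x y l ≡ 0
  walks-outside {x} {y} zero    p rewrite ≤ᵇ-false p | ∧-zeroʳ ((x ≡ᵇ M) ∧ (y ≡ᵇ N)) = refl
  walks-outside         (suc l) p rewrite ≤ᵇ-false p = refl

  walks-zero-at : a * N ≤ M → walks M N 0 ≡ 1
  walks-zero-at p rewrite ≡ᵇ-refl M | ≡ᵇ-refl N | ≤ᵇ-true p = refl

  walks-zero-off : ∀ {x y} → (x ≡ M → y ≡ N → ¬ a * y ≤ x) → walks x y 0 ≡ 0
  walks-zero-off {x} {y} h with x ≟ M | y ≟ N
  ... | yes refl | yes refl = walks-outside 0 (h refl refl)
  ... | no x≢M   | _        rewrite ≡ᵇ-false x≢M = refl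
  ... | yes _    | no y≢N   rewrite ≡ᵇ-false y≢N | ∧-zeroʳ (x ≡ᵇ M) = refl

  walks-vanish : (P : ℕ → ℕ → Set) →
    (∀ {x y} → P x y → P (suc x) y) → (∀ {x y} → P x y → P x (suc y)) →
    (P M N → ¬ a * N ≤ M) →
    ∀ {x y} l → P x y → walks x y l ≡ 0
  walks-vanish P east north target zero    p = walks-zero-off (λ { refl refl → target p })
  walks-vanish P east north target {x} {y} (suc l) p with a * y ≤? x
  ... | yes q = trans (walks-step l q)
                  (cong₂ _+_ (walks-vanish P east north target l (east p))
                             (walks-vanish P east north target l (north p)))
  ... | no q  = walks-outside (suc l) q

  -- Walks never decrease y, so none starts above the target.
  walks-above : ∀ {x y} l → N < y → walks x y l ≡ 0
  walks-above = walks-vanish (λ _ y → N < y) id m<n⇒m<1+n (λ N<N → ⊥-elim (<-irrefl refl N<N))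

  walks-target-outside : ¬ a * N ≤ M → ∀ {x y} l → walks x y l ≡ 0
  walks-target-outside out l = walks-vanish (λ _ _ → ¬ a * N ≤ M) id id id l out

open Walks public

-- Moving start and target by the vector (a , 1) preserves the region, since
-- a·(y+1) ≤ a + x  iff  a·y ≤ x.
≤ᵇ-+ : ∀ c m n → ((c + m) ≤ᵇ (c + n)) ≡ (m ≤ᵇ n)
≤ᵇ-+ zero    m n = refl
≤ᵇ-+ (suc c) m n = trans (<ᵇ-suc (c + m) (c + n)) (≤ᵇ-+ c m n)
  where
  <ᵇ-suc : ∀ m n → (m <ᵇ suc n) ≡ (m ≤ᵇ n)
  <ᵇ-suc zero    n = refl
  <ᵇ-suc (suc m) n = refl

≡ᵇ-+ : ∀ c m n → ((c + m) ≡ᵇ (c + n)) ≡ (m ≡ᵇ n)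
≡ᵇ-+ zero    m n = refl
≡ᵇ-+ (suc c) m n = ≡ᵇ-+ c m n

region-translate : ∀ a x y → (a * suc y ≤ᵇ a + x) ≡ (a * y ≤ᵇ x)
region-translate a x y rewrite *-suc a y = ≤ᵇ-+ a (a * y) x

walks-translate : ∀ a M N x y l → walks a M N x y l ≡ walks a (a + M) (suc N) (a + x) (suc y) l
walks-translate a M N x y zero rewrite ≡ᵇ-+ a x M | region-translate a x y = refl
walks-translate a M N x y (suc l)
  rewrite region-translate a x y
        | walks-translate a M N (suc x) y l | walks-translate a M N x (suc y) l | +-suc a x = refl

-- Iterated translation by j·(a , 1), used to move a boundary point to the origin.
walks-translate* : ∀ a j M N x y l →
  walks a M N x y l ≡ walks a (j * a + M) (j + N) (j * a + x) (j + y) l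
walks-translate* a zero    M N x y l = refl
walks-translate* a (suc j) M N x y l
  rewrite +-assoc a (j * a) M | +-assoc a (j * a) x =
  trans (walks-translate* a j M N x y l) (walks-translate a (j * a + M) (j + N) (j * a + x) (j + y) l)

-- walks ending with an east step (resp. north step): walks to the target's west
-- (resp. south) neighbour, none if the target lies on the y-axis (resp. x-axis).
walksWest : ℕ → ℕ → ℕ → ℕ → ℕ → ℕ → ℕ
walksWest a zero    N x y l = 0
walksWest a (suc M) N x y l = walks a M N x y l

walksSouth : ℕ → ℕ → ℕ → ℕ → ℕ → ℕ → ℕ
walksSouth a M zero    x y l = 0
walksSouth a M (suc N) x y l = walks a M N x y l

walksWest-step : ∀ a M N {x y} l → a * y ≤ x →
  walksWest a M N x y (suc l) ≡ walksWest a M N (suc x) y l + walksWest a M N x (suc y) l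
walksWest-step a zero    N l p = refl
walksWest-step a (suc M) N l p = walks-step a M N l p

walksSouth-step : ∀ a M N {x y} l → a * y ≤ x →
  walksSouth a M N x y (suc l) ≡ walksSouth a M N (suc x) y l + walksSouth a M N x (suc y) l
walksSouth-step a M zero    l p = refl
walksSouth-step a M (suc N) l p = walks-step a M N l p

walksWest-outside : ∀ a M N {x y} l → ¬ a * y ≤ x → walksWest a M N x y l ≡ 0
walksWest-outside a zero    N l p = refl
walksWest-outside a (suc M) N l p = walks-outside a M N l p

walksSouth-outside : ∀ a M N {x y} l → ¬ a * y ≤ x → walksSouth a M N x y l ≡ 0
walksSouth-outside a M zero    l p = refl
walksSouth-outside a M (suc N) l p = walks-outside a M N l p

endpoint-east : ∀ a M N {x y} → a * y ≤ x → walks a M N (suc x) y 0 ≡ walksWest a M N x y 0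
endpoint-east a zero    N {x} {y} p = walks-zero-off a 0 N {suc x} {y} (λ ())
endpoint-east a (suc M) N {x} {y} p with x ≟ M | y ≟ N
... | yes refl | yes refl = trans (walks-zero-at a (suc x) y (m≤n⇒m≤1+n p)) (sym (walks-zero-at a x y p))
... | no x≢M | _ = trans (walks-zero-off a (suc M) N (λ e _ → ⊥-elim (x≢M (suc-injective e))))
                         (sym (walks-zero-off a M N (λ e _ → ⊥-elim (x≢M e))))
... | yes _ | no y≢N = trans (walks-zero-off a (suc M) N (λ _ e → ⊥-elim (y≢N e)))
                             (sym (walks-zero-off a M N (λ _ e → ⊥-elim (y≢N e))))

endpoint-north : ∀ a M N {x y} → a * N ≤ M → walks a M N x (suc y) 0 ≡ walksSouth a M N x y 0
endpoint-north a M zero {x} {y} adm = walks-zero-off a M 0 {x} {suc y} (λ _ ())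
endpoint-north a M (suc N) {x} {y} adm with x ≟ M | y ≟ N
... | yes refl | yes refl = trans (walks-zero-at a x (suc y) adm)
                              (sym (walks-zero-at a x y (≤-trans (*-monoʳ-≤ a (n≤1+n y)) adm)))
... | no x≢M | _ = trans (walks-zero-off a M (suc N) (λ e _ → ⊥-elim (x≢M e)))
                         (sym (walks-zero-off a M N (λ e _ → ⊥-elim (x≢M e))))
... | yes _ | no y≢N = trans (walks-zero-off a M (suc N) (λ _ e → ⊥-elim (y≢N (suc-injective e))))
                             (sym (walks-zero-off a M N (λ _ e → ⊥-elim (y≢N e))))

walks-last-step : ∀ a M N → a * N ≤ M → ∀ x y l →
  walks a M N x y (suc l) ≡ walksWest a M N x y l + walksSouth a M N x y l
walks-last-step a M N adm x y l with a * y ≤? x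
walks-last-step a M N adm x y zero    | yes p =
  trans (walks-step a M N 0 p) (cong₂ _+_ (endpoint-east a M N p) (endpoint-north a M N adm))
walks-last-step a M N adm x y (suc l) | yes p = begin
    walks a M N x y (suc (suc l))
  ≡⟨ walks-step a M N (suc l) p ⟩
    walks a M N (suc x) y (suc l) + walks a M N x (suc y) (suc l)
  ≡⟨ cong₂ _+_ (walks-last-step a M N adm (suc x) y l) (walks-last-step a M N adm x (suc y) l) ⟩
    (walksWest a M N (suc x) y l + walksSouth a M N (suc x) y l)
      + (walksWest a M N x (suc y) l + walksSouth a M N x (suc y) l)
  ≡⟨ interchange (walksWest a M N (suc x) y l) (walksSouth a M N (suc x) y l)
                 (walksWest a M N x (suc y) l) (walksSouth a M N x (suc y) l) ⟩
    (walksWest a M N (suc x) y l + walksWest a M N x (suc y) l)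
      + (walksSouth a M N (suc x) y l + walksSouth a M N x (suc y) l)
  ≡⟨ sym (cong₂ _+_ (walksWest-step a M N l p) (walksSouth-step a M N l p)) ⟩
    walksWest a M N x y (suc l) + walksSouth a M N x y (suc l)
  ∎
  where open ≡-Reasoning
walks-last-step a M N adm x y l       | no p  =
  trans (walks-outside a M N (suc l) p)
        (sym (cong₂ _+_ (walksWest-outside a M N l p) (walksSouth-outside a M N l p)))

-- C' n r = C(n , r - 1), the second term of Pascal's rule (zero for r = 0).
C' : ℕ → ℕ → ℕ
C' n zero    = 0
C' n (suc r) = n C r

pascal : ∀ n r → suc n C r ≡ n C r + C' n r
pascal n zero    = refl
pascal n (suc r) = trans (sym (nCk+nC[k+1]≡[n+1]C[k+1] n r)) (+-comm (n C r) (n C suc r))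

absorb : ∀ n r → r * (suc n C r) ≡ suc n * C' n r
absorb n       zero          = sym (*-zeroʳ (suc n))
absorb zero    (suc zero)    = refl
absorb zero    (suc (suc r)) = *-zeroʳ (suc (suc r))
absorb (suc n) (suc r)       = begin
    suc r * (suc (suc n) C suc r)
  ≡⟨ cong (suc r *_) (pascal (suc n) (suc r)) ⟩
    suc r * (X + Y)
  ≡⟨ expand r X Y ⟩
    suc r * X + (r * Y + Y)
  ≡⟨ cong₂ (λ p q → p + (q + Y)) (absorb n (suc r)) (absorb n r) ⟩
    suc n * (n C r) + (suc n * C' n r + Y)
  ≡⟨ collect (suc n) (n C r) (C' n r) Y ⟩
    suc n * (n C r + C' n r) + Y
  ≡⟨ cong (λ z → suc n * z + Y) (sym (pascal n r)) ⟩
    suc n * Y + Y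
  ≡⟨ +-comm (suc n * Y) Y ⟩
    suc (suc n) * Y
  ∎
  where
  open ≡-Reasoning
  X = suc n C suc r
  Y = suc n C r
  expand : ∀ r x y → suc r * (x + y) ≡ suc r * x + (r * y + y)
  expand = ℕ-Solver.solve-∀
  collect : ∀ c p q y → c * p + (c * q + y) ≡ c * (p + q) + y
  collect = ℕ-Solver.solve-∀

-- The ballot number  C(X+Y+1 , Y) - (a+1)·C(X+Y , Y-1),
-- which equals  (X+1-a·Y)/(X+Y+1) · C(X+Y+1 , Y)  (see fraction-ballot below).
ballot : ℕ → ℕ → ℕ → ℤ
ballot a X Y = + (suc (X + Y) C Y) ℤ.- + (suc a * C' (X + Y) Y)

ballot-pascal : ∀ a X Y → ballot a (suc X) (suc Y) ≡ ballot a X (suc Y) ℤ.+ ballot a (suc X) Y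
ballot-pascal a X Y rewrite sym (+-suc X Y) = begin
    + (suc (suc len) C suc Y) ℤ.- + (k * (suc len C Y))
  ≡⟨ cong₂ (λ p q → + p ℤ.- + (k * q)) (pascal (suc len) (suc Y)) (pascal len Y) ⟩
    + (A + B) ℤ.- + (k * (D + E))
  ≡⟨ cong₂ ℤ._-_ (ℤP.pos-+ A B) (trans (ℤP.pos-* k (D + E)) (cong (+ k ℤ.*_) (ℤP.pos-+ D E))) ⟩
    (+ A ℤ.+ + B) ℤ.- + k ℤ.* (+ D ℤ.+ + E)
  ≡⟨ regroup (+ A) (+ B) (+ k) (+ D) (+ E) ⟩
    (+ A ℤ.- + k ℤ.* + D) ℤ.+ (+ B ℤ.- + k ℤ.* + E)
  ≡⟨ sym (cong₂ (λ p q → (+ A ℤ.- p) ℤ.+ (+ B ℤ.- q)) (ℤP.pos-* k D) (ℤP.pos-* k E)) ⟩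
    (+ A ℤ.- + (k * D)) ℤ.+ (+ B ℤ.- + (k * E))
  ∎
  where
  open ≡-Reasoning
  len = X + suc Y
  k = suc a
  A = suc len C suc Y
  B = suc len C Y
  D = len C Y
  E = C' len Y
  regroup : ∀ a b k d e → (a ℤ.+ b) ℤ.- k ℤ.* (d ℤ.+ e) ≡ (a ℤ.- k ℤ.* d) ℤ.+ (b ℤ.- k ℤ.* e)
  regroup = ℤ-Solver.solve-∀

ballot-boundary : ∀ a X Y → suc X ≡ a * suc Y → ballot a X (suc Y) ≡ + 0
ballot-boundary a X Y e =
  trans (cong (λ z → + z ℤ.- + (suc a * (len C Y))) binomial-eq) (ℤP.+-inverseʳ (+ (suc a * (len C Y))))
  where
  len = X + suc Y
  size : suc len ≡ suc a * suc Y
  size = trans (cong (_+ suc Y) e) (+-comm (a * suc Y) (suc Y))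
  binomial-eq : suc len C suc Y ≡ suc a * (len C Y)
  binomial-eq = *-cancelˡ-≡ _ _ (suc Y) (begin
      suc Y * (suc len C suc Y)   ≡⟨ absorb len (suc Y) ⟩
      suc len * (len C Y)         ≡⟨ cong (_* (len C Y)) size ⟩
      suc a * suc Y * (len C Y)   ≡⟨ rearrange (suc a) (suc Y) (len C Y) ⟩
      suc Y * (suc a * (len C Y)) ∎)
    where
    open ≡-Reasoning
    rearrange : ∀ p q r → p * q * r ≡ q * (p * r)
    rearrange = ℕ-Solver.solve-∀

walks-ballot : ∀ a → 1 ≤ a → ∀ M N → a * N ≤ M → + walks a M N 0 0 (M + N) ≡ ballot a M N
walks-ballot a a≥1 zero zero adm =
  trans (cong +_ (walks-zero-at a 0 0 adm)) (cong (λ z → + 1 ℤ.- + z) (sym (*-zeroʳ (suc a))))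
walks-ballot a a≥1 zero (suc N) adm =
  contradiction (≤-trans a≥1 (≤-trans (m≤m*n a (suc N)) adm)) λ ()
walks-ballot a a≥1 (suc M) zero adm =
  trans (cong +_ (trans (walks-last-step a (suc M) 0 adm 0 0 (M + 0)) (+-identityʳ _)))
        (walks-ballot a a≥1 M 0 (subst (_≤ M) (sym (*-zeroʳ a)) z≤n))
walks-ballot a a≥1 (suc M) (suc N) adm = begin
    + walks a (suc M) (suc N) 0 0 (suc M + suc N)
  ≡⟨ cong +_ (walks-last-step a (suc M) (suc N) adm 0 0 (M + suc N)) ⟩
    + (walks a M (suc N) 0 0 (M + suc N) + walks a (suc M) N 0 0 (M + suc N))
  ≡⟨ ℤP.pos-+ (walks a M (suc N) 0 0 (M + suc N)) (walks a (suc M) N 0 0 (M + suc N)) ⟩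
    + walks a M (suc N) 0 0 (M + suc N) ℤ.+ + walks a (suc M) N 0 0 (M + suc N)
  ≡⟨ cong₂ ℤ._+_ west south ⟩
    ballot a M (suc N) ℤ.+ ballot a (suc M) N
  ≡⟨ sym (ballot-pascal a M N) ⟩
    ballot a (suc M) (suc N)
  ∎
  where
  open ≡-Reasoning
  -- the west neighbour (M , N+1) may lie just outside the region
  west : + walks a M (suc N) 0 0 (M + suc N) ≡ ballot a M (suc N)
  west with a * suc N ≤? M
  ... | yes adm′ = walks-ballot a a≥1 M (suc N) adm′
  ... | no out   = trans (cong +_ (walks-target-outside a M (suc N) out (M + suc N)))
                         (sym (ballot-boundary a M N (≤-antisym (≰⇒> out) adm)))
  south : + walks a (suc M) N 0 0 (M + suc N) ≡ ballot a (suc M) N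
  south rewrite +-suc M N = walks-ballot a a≥1 (suc M) N (≤-trans (*-monoʳ-≤ a (n≤1+n N)) adm)

alt : ℕ → (ℕ → ℤ) → ℤ
alt zero    f = + 0
alt (suc R) f = f 0 ℤ.- alt R (f ∘ suc)

alt-cong : ∀ R {f g} → (∀ i → f i ≡ g i) → alt R f ≡ alt R g
alt-cong zero    e = refl
alt-cong (suc R) e = cong₂ ℤ._-_ (e 0) (alt-cong R (e ∘ suc))

alt-+ : ∀ R f g → alt R (λ i → f i ℤ.+ g i) ≡ alt R f ℤ.+ alt R g
alt-+ zero    f g = refl
alt-+ (suc R) f g =
  trans (cong (λ z → (f 0 ℤ.+ g 0) ℤ.- z) (alt-+ R (f ∘ suc) (g ∘ suc)))
        (regroup (f 0) (g 0) (alt R (f ∘ suc)) (alt R (g ∘ suc)))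
  where
  regroup : ∀ p q r s → (p ℤ.+ q) ℤ.- (r ℤ.+ s) ≡ (p ℤ.- r) ℤ.+ (q ℤ.- s)
  regroup = ℤ-Solver.solve-∀

alt-zero : ∀ R f → (∀ i → f i ≡ + 0) → alt R f ≡ + 0
alt-zero zero    f z = refl
alt-zero (suc R) f z = cong₂ ℤ._-_ (z 0) (alt-zero R (f ∘ suc) (z ∘ suc))

alt-trim : ∀ R S f → R ≤ S → (∀ i → R ≤ i → f i ≡ + 0) → alt S f ≡ alt R f
alt-trim zero    S       f _         z = alt-zero S f (λ i → z i z≤n)
alt-trim (suc R) (suc S) f (s≤s R≤S) z =
  cong (λ w → f 0 ℤ.- w) (alt-trim R S (f ∘ suc) R≤S (λ i R≤i → z (suc i) (s≤s R≤i)))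

coeff : ℕ → ℕ → ℕ → ℕ
coeff a u i = (u ∸ i * a) C i

-- The coefficient vanishes once i·(a+1) > u, i.e. once u - i·a < i.
coeff-vanish : ∀ a u i → u < i * suc a → coeff a u i ≡ 0
coeff-vanish a u zero    ()
coeff-vanish a u (suc i) u<i[a+1] = k>n⇒nCk≡0 (m<n+o⇒m∸n<o u (suc i * a) bound)
  where
  bound : u < suc i * a + suc i
  bound = subst (u <_) (trans (*-suc (suc i) a) (+-comm (suc i) (suc i * a))) u<i[a+1]

coeff-pascal : ∀ a u i → a ≤ u → coeff a (suc u) (suc i) ≡ coeff a u (suc i) + coeff a (u ∸ a) i
coeff-pascal a u i a≤u with a + i * a ≤? u
... | yes fits = begin
    (suc u ∸ t) C suc i
  ≡⟨ cong (_C suc i) (+-∸-assoc 1 fits) ⟩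
    suc (u ∸ t) C suc i
  ≡⟨ sym (nCk+nC[k+1]≡[n+1]C[k+1] (u ∸ t) i) ⟩
    (u ∸ t) C i + (u ∸ t) C suc i
  ≡⟨ +-comm ((u ∸ t) C i) ((u ∸ t) C suc i) ⟩
    (u ∸ t) C suc i + (u ∸ t) C i
  ≡⟨ cong (λ z → (u ∸ t) C suc i + z C i) (sym (∸-+-assoc u a (i * a))) ⟩
    coeff a u (suc i) + coeff a (u ∸ a) i
  ∎
  where
  open ≡-Reasoning
  t = a + i * a
... | no too-big = begin
    (suc u ∸ t) C suc i                  ≡⟨ cong (_C suc i) (m≤n⇒m∸n≡0 u<t) ⟩
    0                                    ≡⟨ sym (cong (_C suc i) (m≤n⇒m∸n≡0 (<⇒≤ u<t))) ⟩
    (u ∸ t) C suc i                      ≡⟨ sym (+-identityʳ _) ⟩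
    coeff a u (suc i) + 0                ≡⟨ cong (λ z → coeff a u (suc i) + z) (sym (lower i too-big)) ⟩
    coeff a u (suc i) + coeff a (u ∸ a) i ∎
  where
  open ≡-Reasoning
  t = a + i * a
  u<t : u < t
  u<t = ≰⇒> too-big
  -- the lower coefficient vanishes too (for i = 0 the case is impossible as a ≤ u)
  lower : ∀ i → ¬ (a + i * a ≤ u) → coeff a (u ∸ a) i ≡ 0
  lower zero    no-fit = contradiction (subst (_≤ u) (sym (+-identityʳ a)) a≤u) no-fit
  lower (suc i) no-fit rewrite ∸-+-assoc u a (suc i * a)
    = cong (_C suc i) (m≤n⇒m∸n≡0 (<⇒≤ (≰⇒> no-fit)))

coeff-beyond : ∀ a u i → u < i → coeff a u i ≡ 0
coeff-beyond a u i u<i = coeff-vanish a u i (≤-trans u<i (m≤m*n i (suc a)))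

expansion : ℕ → (ℕ → ℤ) → ℕ → ℤ
expansion a b u = alt (suc u) (λ i → + coeff a u i ℤ.* b i)

term-vanish : ∀ {c} (z : ℤ) → c ≡ 0 → + c ℤ.* z ≡ + 0
term-vanish z refl = ℤP.*-zeroˡ z

expansion-cong : ∀ a {b c} u → (∀ i → b i ≡ c i) → expansion a b u ≡ expansion a c u
expansion-cong a u e = alt-cong (suc u) (λ i → cong (λ z → + coeff a u i ℤ.* z) (e i))

-- While u < a the expansion does not change: the new coefficients vanish.
expansion-step-small : ∀ a b u → u < a → expansion a b (suc u) ≡ expansion a b u
expansion-step-small a b u u<a = cong (λ z → + 1 ℤ.* b 0 ℤ.- z) (begin
    alt (suc u) (λ i → + coeff a (suc u) (suc i) ℤ.* b (suc i))
  ≡⟨ alt-trim 0 (suc u) _ z≤n (λ i _ → term-vanish (b (suc i)) (coeff-vanish a (suc u) (suc i) (large i))) ⟩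
    + 0
  ≡⟨ sym (alt-trim 0 u _ z≤n (λ i _ → term-vanish (b (suc i))
                                        (coeff-vanish a u (suc i) (<-trans (n<1+n u) (large i))))) ⟩
    alt u (λ i → + coeff a u (suc i) ℤ.* b (suc i))
  ∎)
  where
  open ≡-Reasoning
  large : ∀ i → suc u < suc i * suc a
  large i = ≤-trans (s≤s u<a) (m≤m+n (suc a) (i * suc a))

-- Once u ≥ a, Pascal's rule for the coefficients gives the recursion
-- E_b(u+1) = E_b(u) - E_{b∘suc}(u-a).
expansion-step : ∀ a b u → a ≤ u →
  expansion a b (suc u) ≡ expansion a b u ℤ.- expansion a (b ∘ suc) (u ∸ a)
expansion-step a b u a≤u = begin
    head ℤ.- alt (suc u) (λ i → + coeff a (suc u) (suc i) ℤ.* b (suc i))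
  ≡⟨ cong (λ z → head ℤ.- z) (alt-cong (suc u) split) ⟩
    head ℤ.- alt (suc u) (λ i → X i ℤ.+ Y i)
  ≡⟨ cong (λ z → head ℤ.- z) (alt-+ (suc u) X Y) ⟩
    head ℤ.- (alt (suc u) X ℤ.+ alt (suc u) Y)
  ≡⟨ cong₂ (λ p q → head ℤ.- (p ℤ.+ q)) trim-X trim-Y ⟩
    head ℤ.- (alt u X ℤ.+ expansion a (b ∘ suc) (u ∸ a))
  ≡⟨ regroup head (alt u X) (expansion a (b ∘ suc) (u ∸ a)) ⟩
    (head ℤ.- alt u X) ℤ.- expansion a (b ∘ suc) (u ∸ a)
  ∎
  where
  open ≡-Reasoning
  head = + 1 ℤ.* b 0
  X Y : ℕ → ℤ
  X i = + coeff a u (suc i) ℤ.* b (suc i)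
  Y i = + coeff a (u ∸ a) i ℤ.* b (suc i)
  split : ∀ i → + coeff a (suc u) (suc i) ℤ.* b (suc i) ≡ X i ℤ.+ Y i
  split i = trans (cong (λ c → + c ℤ.* b (suc i)) (coeff-pascal a u i a≤u))
            (trans (cong (ℤ._* b (suc i)) (ℤP.pos-+ (coeff a u (suc i)) (coeff a (u ∸ a) i)))
                   (ℤP.*-distribʳ-+ (b (suc i)) (+ coeff a u (suc i)) (+ coeff a (u ∸ a) i)))
  trim-X : alt (suc u) X ≡ alt u X
  trim-X = alt-trim u (suc u) X (n≤1+n u)
             (λ i u≤i → term-vanish (b (suc i)) (coeff-beyond a u (suc i) (s≤s u≤i)))
  trim-Y : alt (suc u) Y ≡ expansion a (b ∘ suc) (u ∸ a)
  trim-Y = alt-trim (suc (u ∸ a)) (suc u) Y (s≤s (m∸n≤m u a))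
             (λ i u-a<i → term-vanish (b (suc i)) (coeff-beyond a (u ∸ a) i u-a<i))
  regroup : ∀ h x y → h ℤ.- (x ℤ.+ y) ≡ (h ℤ.- x) ℤ.- y
  regroup = ℤ-Solver.solve-∀

expansion-at-0 : ∀ a b → expansion a b 0 ≡ b 0
expansion-at-0 a b = trans (ℤP.+-identityʳ (+ 1 ℤ.* b 0)) (ℤP.*-identityˡ (b 0))

pos-+-minus : ∀ m n → + (m + n) ℤ.- + n ≡ + m
pos-+-minus m n = trans (cong (ℤ._- + n) (ℤP.pos-+ m n)) (cancel (+ m) (+ n))
  where
  cancel : ∀ p q → (p ℤ.+ q) ℤ.- q ≡ p
  cancel = ℤ-Solver.solve-∀

-- The point u ≥ a steps right of the boundary point (y·a , y) of row y is u - a steps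
-- right of the boundary point of row y + 1 ...
row-shift : ∀ a y u → a ≤ u → suc y * a + (u ∸ a) ≡ y * a + u
row-shift a y u a≤u = begin
    (a + y * a) + (u ∸ a)   ≡⟨ +-assoc a (y * a) (u ∸ a) ⟩
    a + (y * a + (u ∸ a))   ≡⟨ cong (λ z → a + z) (+-comm (y * a) (u ∸ a)) ⟩
    a + ((u ∸ a) + y * a)   ≡⟨ sym (+-assoc a (u ∸ a) (y * a)) ⟩
    (a + (u ∸ a)) + y * a   ≡⟨ cong (_+ y * a) (m+[n∸m]≡n a≤u) ⟩
    u + y * a               ≡⟨ +-comm u (y * a) ⟩
    y * a + u               ∎
  where open ≡-Reasoning

-- ... and for u < a, one step north of it leaves the region.
row-outside : ∀ a y u → u < a → ¬ a * suc y ≤ y * a + u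
row-outside a y u u<a a[y+1]≤ = <⇒≱ u<a (+-cancelˡ-≤ (y * a) a u (subst (_≤ y * a + u) a[y+1]≡ a[y+1]≤))
  where
  a[y+1]≡ : a * suc y ≡ y * a + a
  a[y+1]≡ = trans (*-suc a y) (trans (cong (λ z → a + z) (*-comm a y)) (+-comm a (y * a)))

module Target (a M N : ℕ) (a≥1 : 1 ≤ a) (adm : a * N ≤ M) where

  toTarget : ℕ → ℕ → ℕ
  toTarget x y = walks a M N x y ((M ∸ x) + (N ∸ y))

  -- the walk count from the boundary point (j·a , j), a ballot number
  -- (zero when row j lies above the target)
  boundary : ℕ → ℤ
  boundary j with j ≤? N
  ... | yes _ = ballot a (M ∸ j * a) (N ∸ j)
  ... | no  _ = + 0

  toTarget-boundary : ∀ j → j * a ≤ M → + toTarget (j * a) j ≡ boundary j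
  toTarget-boundary j ja≤M with j ≤? N
  ... | no  j≰N = cong +_ (walks-above a M N {j * a} ((M ∸ j * a) + (N ∸ j)) (≰⇒> j≰N))
  ... | yes j≤N = trans (cong +_ translated) (walks-ballot a a≥1 M′ N′ adm′)
    where
    M′ = M ∸ j * a
    N′ = N ∸ j
    translated : walks a M N (j * a) j (M′ + N′) ≡ walks a M′ N′ 0 0 (M′ + N′)
    translated = sym (begin
        walks a M′ N′ 0 0 (M′ + N′)
      ≡⟨ walks-translate* a j M′ N′ 0 0 (M′ + N′) ⟩
        walks a (j * a + M′) (j + N′) (j * a + 0) (j + 0) (M′ + N′)
      ≡⟨ cong₂ (λ p q → walks a p q (j * a + 0) (j + 0) (M′ + N′))
               (m+[n∸m]≡n ja≤M) (m+[n∸m]≡n j≤N) ⟩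
        walks a M N (j * a + 0) (j + 0) (M′ + N′)
      ≡⟨ cong₂ (λ p q → walks a M N p q (M′ + N′)) (+-identityʳ (j * a)) (+-identityʳ j) ⟩
        walks a M N (j * a) j (M′ + N′)
      ∎)
      where open ≡-Reasoning
    adm′ : a * N′ ≤ M′
    adm′ = subst (_≤ M′) (sym (*-distribˡ-∸ a N j))
             (subst (λ z → a * N ∸ z ≤ M′) (*-comm j a) (∸-monoˡ-≤ (j * a) adm))

  toTarget-first-step : ∀ x y → a * y ≤ x → x < M → toTarget x y ≡ toTarget (suc x) y + toTarget x (suc y)
  toTarget-first-step x y inside x<M = begin
      walks a M N x y ((M ∸ x) + (N ∸ y))
    ≡⟨ cong (λ d → walks a M N x y (d + (N ∸ y))) (+-∸-assoc 1 x<M) ⟩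
      walks a M N x y (suc ((M ∸ suc x) + (N ∸ y)))
    ≡⟨ walks-step a M N ((M ∸ suc x) + (N ∸ y)) inside ⟩
      toTarget (suc x) y + walks a M N x (suc y) ((M ∸ suc x) + (N ∸ y))
    ≡⟨ cong (λ z → toTarget (suc x) y + z) north ⟩
      toTarget (suc x) y + toTarget x (suc y)
    ∎
    where
    open ≡-Reasoning
    north : walks a M N x (suc y) ((M ∸ suc x) + (N ∸ y)) ≡ toTarget x (suc y)
    north with y <? N
    ... | yes y<N = cong (walks a M N x (suc y)) (begin
        (M ∸ suc x) + (N ∸ y)             ≡⟨ cong (λ d → (M ∸ suc x) + d) (+-∸-assoc 1 y<N) ⟩
        (M ∸ suc x) + suc (N ∸ suc y)     ≡⟨ +-suc (M ∸ suc x) (N ∸ suc y) ⟩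
        suc ((M ∸ suc x) + (N ∸ suc y))   ≡⟨ cong (_+ (N ∸ suc y)) (sym (+-∸-assoc 1 x<M)) ⟩
        (M ∸ x) + (N ∸ suc y)             ∎)
    ... | no  y≮N = trans (walks-above a M N {x} ((M ∸ suc x) + (N ∸ y)) (≰⇒> y≮N))
                          (sym (walks-above a M N {x} ((M ∸ x) + (N ∸ suc y)) (≰⇒> y≮N)))

  boundaryFrom : ℕ → ℕ → ℤ
  boundaryFrom y i = boundary (y + i)

  Expands : ℕ → Set
  Expands u = ∀ y → y * a + u ≤ M → + toTarget (y * a + u) y ≡ expansion a (boundaryFrom y) u

  -- Strong induction on u: the walks from x + 1 are those from x minus those whose
  -- first step goes north; the latter start u - a steps right of the boundary point
  -- of row y + 1, or outside the region when u < a.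
  toTarget-expansion : ∀ u → Expands u
  toTarget-expansion = <-rec Expands expand
    where
    expand : ∀ u → (∀ {v} → v < u → Expands v) → Expands u
    expand zero _ y fits rewrite +-identityʳ (y * a) =
      trans (toTarget-boundary y fits) (trans (cong boundary (sym (+-identityʳ y)))
                                              (sym (expansion-at-0 a (boundaryFrom y))))
    expand (suc u) rec y fits rewrite +-suc (y * a) u = begin
        + toTarget (suc x) y
      ≡⟨ sym (pos-+-minus (toTarget (suc x) y) (toTarget x (suc y))) ⟩
        + (toTarget (suc x) y + toTarget x (suc y)) ℤ.- + toTarget x (suc y)
      ≡⟨ cong (λ z → + z ℤ.- + toTarget x (suc y)) (sym (toTarget-first-step x y inside fits)) ⟩
        + toTarget x y ℤ.- + toTarget x (suc y)
      ≡⟨ cong (ℤ._- + toTarget x (suc y)) (rec (n<1+n u) y (<⇒≤ fits)) ⟩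
        expansion a b u ℤ.- + toTarget x (suc y)
      ≡⟨ north ⟩
        expansion a b (suc u)
      ∎
      where
      open ≡-Reasoning
      x = y * a + u
      b = boundaryFrom y
      inside : a * y ≤ x
      inside = subst (_≤ x) (*-comm y a) (m≤m+n (y * a) u)
      north : expansion a b u ℤ.- + toTarget x (suc y) ≡ expansion a b (suc u)
      north with a ≤? u
      ... | no u≱a = begin
          expansion a b u ℤ.- + toTarget x (suc y)
        ≡⟨ cong (λ z → expansion a b u ℤ.- + z)
                (walks-outside a M N ((M ∸ x) + (N ∸ suc y)) (row-outside a y u (≰⇒> u≱a))) ⟩
          expansion a b u ℤ.- + 0
        ≡⟨ ℤP.+-identityʳ (expansion a b u) ⟩
          expansion a b u
        ≡⟨ sym (expansion-step-small a b u (≰⇒> u≱a)) ⟩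
          expansion a b (suc u)
        ∎
      ... | yes a≤u = begin
          expansion a b u ℤ.- + toTarget x (suc y)
        ≡⟨ cong (λ z → expansion a b u ℤ.- + toTarget z (suc y)) (sym (row-shift a y u a≤u)) ⟩
          expansion a b u ℤ.- + toTarget (suc y * a + (u ∸ a)) (suc y)
        ≡⟨ cong (λ z → expansion a b u ℤ.- z)
                (rec (s≤s (m∸n≤m u a)) (suc y) (subst (_≤ M) (sym (row-shift a y u a≤u)) (<⇒≤ fits))) ⟩
          expansion a b u ℤ.- expansion a (boundaryFrom (suc y)) (u ∸ a)
        ≡⟨ cong (λ z → expansion a b u ℤ.- z)
                (expansion-cong a (u ∸ a) (λ i → cong boundary (sym (+-suc y i)))) ⟩
          expansion a b u ℤ.- expansion a (b ∘ suc) (u ∸ a)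
        ≡⟨ sym (expansion-step a b u a≤u) ⟩
          expansion a b (suc u)
        ∎

-- The embedding of ℤ into ℚ is a ring homomorphism; equalities in ℚ are
-- checked on the unnormalised representatives, where p / (d+1) is mkℚᵘ p d.
fromℤ : ℤ → ℚ
fromℤ z = z ℚ./ 1

toℚᵘ-/ : ∀ p d → toℚᵘ (p ℚ./ suc d) ≃ᵘ mkℚᵘ p d
toℚᵘ-/ p d = ℚP.toℚᵘ-fromℚᵘ (mkℚᵘ p d)

fromℤ-+ : ∀ x y → fromℤ (x ℤ.+ y) ≡ fromℤ x ℚ.+ fromℤ y
fromℤ-+ x y = ℚP.toℚᵘ-injective (begin
    toℚᵘ (fromℤ (x ℤ.+ y))
  ≈⟨ toℚᵘ-/ (x ℤ.+ y) 0 ⟩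
    mkℚᵘ (x ℤ.+ y) 0
  ≈⟨ *≡* (units x y) ⟩
    mkℚᵘ x 0 ℚᵘ.+ mkℚᵘ y 0
  ≈⟨ ℚᵘP.+-cong (ℚᵘP.≃-sym (toℚᵘ-/ x 0)) (ℚᵘP.≃-sym (toℚᵘ-/ y 0)) ⟩
    toℚᵘ (fromℤ x) ℚᵘ.+ toℚᵘ (fromℤ y)
  ≈⟨ ℚᵘP.≃-sym (ℚP.toℚᵘ-homo-+ (fromℤ x) (fromℤ y)) ⟩
    toℚᵘ (fromℤ x ℚ.+ fromℤ y)
  ∎)
  where
  open ℚᵘP.≃-Reasoning
  units : ∀ x y → (x ℤ.+ y) ℤ.* + 1 ≡ (x ℤ.* + 1 ℤ.+ y ℤ.* + 1) ℤ.* + 1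
  units = ℤ-Solver.solve-∀

fromℤ-* : ∀ x y → fromℤ (x ℤ.* y) ≡ fromℤ x ℚ.* fromℤ y
fromℤ-* x y = ℚP.toℚᵘ-injective (begin
    toℚᵘ (fromℤ (x ℤ.* y))
  ≈⟨ toℚᵘ-/ (x ℤ.* y) 0 ⟩
    mkℚᵘ (x ℤ.* y) 0
  ≈⟨ ℚᵘP.≃-refl ⟩
    mkℚᵘ x 0 ℚᵘ.* mkℚᵘ y 0
  ≈⟨ ℚᵘP.*-cong (ℚᵘP.≃-sym (toℚᵘ-/ x 0)) (ℚᵘP.≃-sym (toℚᵘ-/ y 0)) ⟩
    toℚᵘ (fromℤ x) ℚᵘ.* toℚᵘ (fromℤ y)
  ≈⟨ ℚᵘP.≃-sym (ℚP.toℚᵘ-homo-* (fromℤ x) (fromℤ y)) ⟩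
    toℚᵘ (fromℤ x ℚ.* fromℤ y)
  ∎)
  where open ℚᵘP.≃-Reasoning

fromℤ-neg : ∀ x → fromℤ (ℤ.- x) ≡ ℚ.- fromℤ x
fromℤ-neg x = ℚP.toℚᵘ-injective (begin
    toℚᵘ (fromℤ (ℤ.- x))      ≈⟨ toℚᵘ-/ (ℤ.- x) 0 ⟩
    mkℚᵘ (ℤ.- x) 0            ≈⟨ ℚᵘP.-‿cong (ℚᵘP.≃-sym (toℚᵘ-/ x 0)) ⟩
    ℚᵘ.- toℚᵘ (fromℤ x)       ≈⟨ ℚᵘP.≃-sym (ℚP.toℚᵘ-homo‿- (fromℤ x)) ⟩
    toℚᵘ (ℚ.- fromℤ x)        ∎)
  where open ℚᵘP.≃-Reasoning

fraction-mul : ∀ p c d z → p ℤ.* c ≡ + suc d ℤ.* z → (p ℚ./ suc d) ℚ.* fromℤ c ≡ fromℤ z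
fraction-mul p c d z h = ℚP.toℚᵘ-injective (begin
    toℚᵘ ((p ℚ./ suc d) ℚ.* fromℤ c)        ≈⟨ ℚP.toℚᵘ-homo-* (p ℚ./ suc d) (fromℤ c) ⟩
    toℚᵘ (p ℚ./ suc d) ℚᵘ.* toℚᵘ (fromℤ c)  ≈⟨ ℚᵘP.*-cong (toℚᵘ-/ p d) (toℚᵘ-/ c 0) ⟩
    mkℚᵘ (p ℤ.* c) (d * 1)                  ≈⟨ *≡* cross ⟩
    mkℚᵘ z 0                                ≈⟨ ℚᵘP.≃-sym (toℚᵘ-/ z 0) ⟩
    toℚᵘ (fromℤ z)                          ∎)
  where
  open ℚᵘP.≃-Reasoning
  cross : (p ℤ.* c) ℤ.* + 1 ≡ z ℤ.* + suc (d * 1)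
  cross rewrite *-identityʳ d | ℤP.*-identityʳ (p ℤ.* c) = trans h (ℤP.*-comm (+ suc d) z)

sgnZ : ℕ → ℤ
sgnZ zero    = + 1
sgnZ (suc i) = ℤ.- sgnZ i

sgn-fromℤ : ∀ i → sgn i ≡ fromℤ (sgnZ i)
sgn-fromℤ zero    = refl
sgn-fromℤ (suc i) = trans (cong ℚ.-_ (sgn-fromℤ i)) (sym (fromℤ-neg (sgnZ i)))

sumZ : ℕ → (ℕ → ℤ) → ℤ
sumZ zero    h = + 0
sumZ (suc R) h = h 0 ℤ.+ sumZ R (h ∘ suc)

sumZ-cong : ∀ R {f g} → (∀ i → f i ≡ g i) → sumZ R f ≡ sumZ R g
sumZ-cong zero    e = refl
sumZ-cong (suc R) e = cong₂ ℤ._+_ (e 0) (sumZ-cong R (e ∘ suc))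

sumZ-neg : ∀ R f → sumZ R (λ i → ℤ.- f i) ≡ ℤ.- sumZ R f
sumZ-neg zero    f = refl
sumZ-neg (suc R) f =
  trans (cong (λ z → ℤ.- f 0 ℤ.+ z) (sumZ-neg R (f ∘ suc))) (sym (ℤP.neg-distrib-+ (f 0) (sumZ R (f ∘ suc))))

alt-sumZ : ∀ R h → alt R h ≡ sumZ R (λ i → sgnZ i ℤ.* h i)
alt-sumZ zero    h = refl
alt-sumZ (suc R) h = begin
    h 0 ℤ.- alt R (h ∘ suc)
  ≡⟨ cong (λ z → h 0 ℤ.- z) (alt-sumZ R (h ∘ suc)) ⟩
    h 0 ℤ.- sumZ R (λ i → sgnZ i ℤ.* h (suc i))
  ≡⟨ cong (λ z → h 0 ℤ.+ z) (sym (sumZ-neg R (λ i → sgnZ i ℤ.* h (suc i)))) ⟩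
    h 0 ℤ.+ sumZ R (λ i → ℤ.- (sgnZ i ℤ.* h (suc i)))
  ≡⟨ cong₂ ℤ._+_ (sym (ℤP.*-identityˡ (h 0)))
                 (sumZ-cong R (λ i → ℤP.neg-distribˡ-* (sgnZ i) (h (suc i)))) ⟩
    sumZ (suc R) (λ i → sgnZ i ℤ.* h i)
  ∎
  where open ≡-Reasoning

foldr-fromℤ : ∀ R (g : ℕ → ℕ) (f : ℕ → ℚ) h → (∀ i → f (g i) ≡ fromℤ (h i)) →
  foldr ℚ._+_ 0ℚ (map f (applyUpTo g R)) ≡ fromℤ (sumZ R h)
foldr-fromℤ zero    g f h e = refl
foldr-fromℤ (suc R) g f h e =
  trans (cong₂ ℚ._+_ (e 0) (foldr-fromℤ R (g ∘ suc) f (h ∘ suc) (e ∘ suc)))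
        (sym (fromℤ-+ (h 0) (sumZ R (h ∘ suc))))

sumTo-alt : ∀ F (f : ℕ → ℚ) h → (∀ i → f i ≡ fromℤ (sgnZ i ℤ.* h i)) →
  sumTo F f ≡ fromℤ (alt (suc F) h)
sumTo-alt F f h e =
  trans (foldr-fromℤ (suc F) id f (λ i → sgnZ i ℤ.* h i) e) (cong fromℤ (sym (alt-sumZ (suc F) h)))

fraction-ballot : ∀ a X Y →
  ((+ suc X ℤ.- + a ℤ.* + Y) ℚ./ suc (X + Y)) ℚ.* fromℤ (+ (suc (X + Y) C Y)) ≡ fromℤ (ballot a X Y)
fraction-ballot a X Y = fraction-mul (+ suc X ℤ.- + a ℤ.* + Y) (+ c) (X + Y) (ballot a X Y) (begin
    (+ 1 ℤ.+ x ℤ.- k ℤ.* y) ℤ.* + c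
  ≡⟨ spread x y k (+ c) ⟩
    (+ 1 ℤ.+ x ℤ.+ y) ℤ.* + c ℤ.- (+ 1 ℤ.+ k) ℤ.* (y ℤ.* + c)
  ≡⟨ cong (λ z → (+ 1 ℤ.+ x ℤ.+ y) ℤ.* + c ℤ.- (+ 1 ℤ.+ k) ℤ.* z) absorbed ⟩
    (+ 1 ℤ.+ x ℤ.+ y) ℤ.* + c ℤ.- (+ 1 ℤ.+ k) ℤ.* ((+ 1 ℤ.+ x ℤ.+ y) ℤ.* + e)
  ≡⟨ collect x y k (+ c) (+ e) ⟩
    (+ 1 ℤ.+ x ℤ.+ y) ℤ.* (+ c ℤ.- (+ 1 ℤ.+ k) ℤ.* + e)
  ≡⟨ cong (λ z → + suc (X + Y) ℤ.* (+ c ℤ.- z)) (sym (ℤP.pos-* (suc a) e)) ⟩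
    + suc (X + Y) ℤ.* ballot a X Y
  ∎)
  where
  open ≡-Reasoning
  x y k : ℤ
  x = + X
  y = + Y
  k = + a
  c e : ℕ
  c = suc (X + Y) C Y
  e = C' (X + Y) Y
  absorbed : y ℤ.* + c ≡ (+ 1 ℤ.+ x ℤ.+ y) ℤ.* + e
  absorbed = trans (sym (ℤP.pos-* Y c)) (trans (cong +_ (absorb (X + Y) Y)) (ℤP.pos-* (suc (X + Y)) e))
  spread : ∀ x y k c →
    (+ 1 ℤ.+ x ℤ.- k ℤ.* y) ℤ.* c ≡ (+ 1 ℤ.+ x ℤ.+ y) ℤ.* c ℤ.- (+ 1 ℤ.+ k) ℤ.* (y ℤ.* c)
  spread = ℤ-Solver.solve-∀
  collect : ∀ x y k c e → (+ 1 ℤ.+ x ℤ.+ y) ℤ.* c ℤ.- (+ 1 ℤ.+ k) ℤ.* ((+ 1 ℤ.+ x ℤ.+ y) ℤ.* e)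
                         ≡ (+ 1 ℤ.+ x ℤ.+ y) ℤ.* (c ℤ.- (+ 1 ℤ.+ k) ℤ.* e)
  collect = ℤ-Solver.solve-∀

beyond-quotient : ∀ u d i .{{_ : NonZero d}} → u / d < i → u < i * d
beyond-quotient u d i q<i = begin-strict
    u                   ≡⟨ m≡m%n+[m/n]*n u d ⟩
    u % d + (u / d) * d <⟨ +-monoˡ-< ((u / d) * d) (m%n<n u d) ⟩
    d + (u / d) * d     ≤⟨ *-monoˡ-≤ d q<i ⟩
    i * d               ∎
  where open ≤-Reasoning

numerator-shift : ∀ a X Y i → + suc (X + i * a) ℤ.- + a ℤ.* + (Y + i) ≡ + suc X ℤ.- + a ℤ.* + Y
numerator-shift a X Y i =
  trans (cong (λ z → + 1 ℤ.+ (+ X ℤ.+ z) ℤ.- + a ℤ.* (+ Y ℤ.+ + i)) (ℤP.pos-* i a))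
        (cancel (+ X) (+ Y) (+ i) (+ a))
  where
  cancel : ∀ x y i a → + 1 ℤ.+ (x ℤ.+ i ℤ.* a) ℤ.- a ℤ.* (y ℤ.+ i) ≡ + 1 ℤ.+ x ℤ.- a ℤ.* y
  cancel = ℤ-Solver.solve-∀

-- The summands of the theorem for m = M + 1, n = N + 1, k = a + 1, matched termwise
-- with the expansion of the walk count from (u , 0).
module Summands (a M N u : ℕ) (a≥1 : 1 ≤ a) (adm : a * N ≤ M) (u≤M : u ≤ M) where
  open Target a M N a≥1 adm

  -- the ingredients m - (k-1)(n-1), m + n - 1 - k·i and n - 1 - i of the i-th summand
  numerator : ℤ
  numerator = + suc M ℤ.- + a ℤ.* + N

  size : ℕ → ℕ
  size i = (suc M + suc N ∸ 1) ∸ suc a * i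

  lower : ℕ → ℤ
  lower i = (+ suc N ℤ.- + 1) ℤ.- + i

  fraction-boundary : ∀ i → i * suc a ≤ u →
    frac numerator (size i) ℚ.* fromℤ (+ binomZ (size i) (lower i)) ≡ fromℤ (boundary i)
  fraction-boundary i fits with i ≤? N
  -- above the target row n - 1 - i < 0, so the binomial coefficient is zero
  ... | no  i≰N rewrite ℤP.m-n≡m⊖n N i | ℤP.⊖-< (≰⇒> i≰N) | +-∸-assoc 1 (≰⇒> i≰N) =
    ℚP.*-zeroʳ (frac numerator (size i))
  ... | yes i≤N = begin
      frac numerator (size i) ℚ.* fromℤ (+ binomZ (size i) (lower i))
    ≡⟨ cong₂ (λ n r → frac numerator n ℚ.* fromℤ (+ binomZ n r)) size≡ lower≡ ⟩
      (numerator ℚ./ suc (X + Y)) ℚ.* fromℤ (+ (suc (X + Y) C Y))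
    ≡⟨ cong (λ p → (p ℚ./ suc (X + Y)) ℚ.* fromℤ (+ (suc (X + Y) C Y))) numerator≡ ⟩
      ((+ suc X ℤ.- + a ℤ.* + Y) ℚ./ suc (X + Y)) ℚ.* fromℤ (+ (suc (X + Y) C Y))
    ≡⟨ fraction-ballot a X Y ⟩
      fromℤ (ballot a X Y)
    ∎
    where
    open ≡-Reasoning
    X = M ∸ i * a
    Y = N ∸ i
    eM : X + i * a ≡ M
    eM = m∸n+n≡m (≤-trans (*-monoʳ-≤ i (n≤1+n a)) (≤-trans fits u≤M))
    eN : Y + i ≡ N
    eN = m∸n+n≡m i≤N
    size≡ : size i ≡ suc (X + Y)
    size≡ = begin
        (M + suc N) ∸ suc a * i
      ≡⟨ cong₂ (λ m n → (m + suc n) ∸ suc a * i) (sym eM) (sym eN) ⟩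
        ((X + i * a) + suc (Y + i)) ∸ suc a * i
      ≡⟨ cong (_∸ suc a * i) (regroup X Y i a) ⟩
        (suc (X + Y) + suc a * i) ∸ suc a * i
      ≡⟨ m+n∸n≡m (suc (X + Y)) (suc a * i) ⟩
        suc (X + Y)
      ∎
      where
      regroup : ∀ X Y i a → (X + i * a) + suc (Y + i) ≡ suc (X + Y) + suc a * i
      regroup = ℕ-Solver.solve-∀
    lower≡ : lower i ≡ + Y
    lower≡ = trans (ℤP.m-n≡m⊖n N i) (ℤP.⊖-≥ i≤N)
    numerator≡ : numerator ≡ + suc X ℤ.- + a ℤ.* + Y
    numerator≡ = trans (cong₂ (λ m n → + suc m ℤ.- + a ℤ.* + n) (sym eM) (sym eN)) (numerator-shift a X Y i)

  summand-term : ∀ i → summand (suc M) (suc N) u (suc a) i ≡ fromℤ (sgnZ i ℤ.* (+ coeff a u i ℤ.* boundary i))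
  summand-term i with i * suc a ≤? u
  ... | no  i≰ = begin
      ((sgn i ℚ.* q) ℚ.* b) ℚ.* fromℤ (+ ((u ∸ a * i) C i))
    ≡⟨ cong (λ t → ((sgn i ℚ.* q) ℚ.* b) ℚ.* fromℤ (+ ((u ∸ t) C i))) (*-comm a i) ⟩
      ((sgn i ℚ.* q) ℚ.* b) ℚ.* fromℤ (+ coeff a u i)
    ≡⟨ cong (λ t → ((sgn i ℚ.* q) ℚ.* b) ℚ.* fromℤ (+ t)) (coeff-vanish a u i (≰⇒> i≰)) ⟩
      ((sgn i ℚ.* q) ℚ.* b) ℚ.* 0ℚ
    ≡⟨ ℚP.*-zeroʳ ((sgn i ℚ.* q) ℚ.* b) ⟩
      fromℤ (+ 0)
    ≡⟨ cong fromℤ (sym (trans (cong (λ z → sgnZ i ℤ.* z)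
                                    (term-vanish (boundary i) (coeff-vanish a u i (≰⇒> i≰))))
                              (ℤP.*-zeroʳ (sgnZ i)))) ⟩
      fromℤ (sgnZ i ℤ.* (+ coeff a u i ℤ.* boundary i))
    ∎
    where
    open ≡-Reasoning
    q = frac numerator (size i)
    b = fromℤ (+ binomZ (size i) (lower i))
  ... | yes fits = begin
      ((sgn i ℚ.* q) ℚ.* b) ℚ.* fromℤ (+ ((u ∸ a * i) C i))
    ≡⟨ cong (λ t → ((sgn i ℚ.* q) ℚ.* b) ℚ.* fromℤ (+ ((u ∸ t) C i))) (*-comm a i) ⟩
      ((sgn i ℚ.* q) ℚ.* b) ℚ.* c
    ≡⟨ cong (ℚ._* c) (ℚP.*-assoc (sgn i) q b) ⟩
      (sgn i ℚ.* (q ℚ.* b)) ℚ.* c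
    ≡⟨ cong₂ (λ p r → (p ℚ.* r) ℚ.* c) (sgn-fromℤ i) (fraction-boundary i fits) ⟩
      (fromℤ (sgnZ i) ℚ.* fromℤ (boundary i)) ℚ.* c
    ≡⟨ sym (trans (fromℤ-* (sgnZ i ℤ.* boundary i) (+ coeff a u i))
                  (cong (ℚ._* c) (fromℤ-* (sgnZ i) (boundary i)))) ⟩
      fromℤ ((sgnZ i ℤ.* boundary i) ℤ.* + coeff a u i)
    ≡⟨ cong fromℤ (reorder (sgnZ i) (boundary i) (+ coeff a u i)) ⟩
      fromℤ (sgnZ i ℤ.* (+ coeff a u i ℤ.* boundary i))
    ∎
    where
    open ≡-Reasoning
    q = frac numerator (size i)
    b = fromℤ (+ binomZ (size i) (lower i))
    c = fromℤ (+ coeff a u i)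
    reorder : ∀ s b c → (s ℤ.* b) ℤ.* c ≡ s ℤ.* (c ℤ.* b)
    reorder = ℤ-Solver.solve-∀

  expansion-sum : fromℤ (expansion a boundary u) ≡ sumTo (u / suc a) (summand (suc M) (suc N) u (suc a))
  expansion-sum = begin
      fromℤ (alt (suc u) term)
    ≡⟨ cong fromℤ (alt-trim (suc F) (suc u) term (s≤s (m/n≤m u (suc a))) vanish) ⟩
      fromℤ (alt (suc F) term)
    ≡⟨ sym (sumTo-alt F (summand (suc M) (suc N) u (suc a)) term summand-term) ⟩
      sumTo F (summand (suc M) (suc N) u (suc a))
    ∎
    where
    open ≡-Reasoning
    F = u / suc a
    term : ℕ → ℤ
    term i = + coeff a u i ℤ.* boundary i
    vanish : ∀ i → suc F ≤ i → term i ≡ + 0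
    vanish i F<i = term-vanish (boundary i) (coeff-vanish a u i (beyond-quotient u (suc a) i F<i))

-- If a·N = M + 1 the numerator m - (k-1)(n-1) is zero and so is every summand.
sumTo-degenerate : ∀ a M N u → a * N ≡ suc M → sumTo (u / suc a) (summand (suc M) (suc N) u (suc a)) ≡ 0ℚ
sumTo-degenerate a M N u on-line =
  trans (sumTo-alt (u / suc a) (summand (suc M) (suc N) u (suc a)) (λ _ → + 0) zero-term)
        (cong fromℤ (alt-zero (suc (u / suc a)) (λ _ → + 0) (λ _ → refl)))
  where
  numerator-zero : + suc M ℤ.- + a ℤ.* + N ≡ + 0
  numerator-zero = trans (cong (λ t → + suc M ℤ.- t) (trans (sym (ℤP.pos-* a N)) (cong +_ on-line)))
                         (ℤP.+-inverseʳ (+ suc M))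
  frac-zero : ∀ d → frac (+ 0) d ≡ 0ℚ
  frac-zero zero    = refl
  frac-zero (suc d) = ℚP.0/n≡0 (suc d)
  zero-term : ∀ i → summand (suc M) (suc N) u (suc a) i ≡ fromℤ (sgnZ i ℤ.* + 0)
  zero-term i = begin
      ((sgn i ℚ.* frac (+ suc M ℤ.- + a ℤ.* + N) d) ℚ.* b) ℚ.* c
    ≡⟨ cong (λ p → ((sgn i ℚ.* frac p d) ℚ.* b) ℚ.* c) numerator-zero ⟩
      ((sgn i ℚ.* frac (+ 0) d) ℚ.* b) ℚ.* c
    ≡⟨ cong (λ f → ((sgn i ℚ.* f) ℚ.* b) ℚ.* c) (frac-zero d) ⟩
      ((sgn i ℚ.* 0ℚ) ℚ.* b) ℚ.* c
    ≡⟨ cong (λ f → (f ℚ.* b) ℚ.* c) (ℚP.*-zeroʳ (sgn i)) ⟩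
      (0ℚ ℚ.* b) ℚ.* c
    ≡⟨ trans (cong (ℚ._* c) (ℚP.*-zeroˡ b)) (ℚP.*-zeroˡ c) ⟩
      fromℤ (+ 0)
    ≡⟨ cong fromℤ (sym (ℤP.*-zeroʳ (sgnZ i))) ⟩
      fromℤ (sgnZ i ℤ.* + 0)
    ∎
    where
    open ≡-Reasoning
    d = (suc M + suc N ∸ 1) ∸ suc a * i
    b = fromℤ (+ binomZ d ((+ suc N ℤ.- + 1) ℤ.- + i))
    c = fromℤ (+ ((u ∸ a * i) C i))

walks-formula : ∀ a M N u → 1 ≤ a → u ≤ M → a * N ≤ suc M →
  fromℤ (+ walks a M N u 0 ((M ∸ u) + N)) ≡ sumTo (u / suc a) (summand (suc M) (suc N) u (suc a))
walks-formula a M N u a≥1 u≤M a*N≤M+1 with a * N ≤? M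
... | yes adm = trans (cong fromℤ (Target.toTarget-expansion a M N a≥1 adm u 0 u≤M))
                      (Summands.expansion-sum a M N u a≥1 adm u≤M)
... | no  out = trans (cong (fromℤ ∘ +_) (walks-target-outside a M N out ((M ∸ u) + N)))
                      (sym (sumTo-degenerate a M N u (≤-antisym a*N≤M+1 (≰⇒> out))))

-- The paths of the theorem, from (u+1 , 1) to (M+1 , N+1) under the line of slope 1/(k-1),
-- are the walks of this file with a = k - 1.
numL-walks : ∀ a M N u → numL (suc u) 1 (suc M) (suc N) (suc a) ≡ walks a M N u 0 ((M ∸ u) + N)
numL-walks a M N u =
  trans (length-filter (inL (suc u) 1 (suc M) (suc N) (suc a)) (allSeqs ((M ∸ u) + N)))
        (count-walks a M N u 0 ((M ∸ u) + N))

-- Lemma 2.1, with m = M + 1, n = N + 1, k = a + 1; the bound on m yields u ≤ M and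
-- a·N ≤ M + 1 (and rules out m = 0).
lemma2p1 : (m n u k : ℕ) → 2 ≤ k → 2 ≤ n →
    (suc u ⊔ (k ∸ 1) * (n ∸ 1)) ≤ m →
    toℚ (numL (suc u) 1 m n k) ≡ sumTo (floorDiv u k) (summand m n u k)
lemma2p1 zero n u k _ _ bound = contradiction (≤-trans (m≤m⊔n (suc u) ((k ∸ 1) * (n ∸ 1))) bound) λ ()
lemma2p1 (suc M) (suc (suc N)) u (suc (suc a)) (s≤s (s≤s z≤n)) (s≤s (s≤s z≤n)) bound =
  trans (cong (fromℤ ∘ +_) (numL-walks (suc a) M (suc N) u))
        (walks-formula (suc a) M (suc N) u (s≤s z≤n) u≤M (≤-trans (m≤n⊔m (suc u) _) bound))
  where
  u≤M : u ≤ M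
  u≤M = s≤s⁻¹ (≤-trans (m≤m⊔n (suc u) (suc a * suc N)) bound)
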